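{- Let $P$ be a polyomino with $n$ cells whose perimeter equals the minimum perimeter $p(n)=2\lceil 2\sqrt{n}\rceil$ among polyominoes with $n$ cells, and suppose $h_1=0$ (no cell of $P$ on its boundary cycle has degree $1$). Then $P$ can be obtained by deleting cells from a rectangular polyomino (an $a\times b$ rectangle of cells) with perimeter $p(n)$ consisting of at least $n$ cells.
   Context: A polyomino is a finite set of unit squares (cells) of the integer grid, connected via shared edges; its perimeter is the number of unit edges belonging to exactly one cell. The degree of a cell is the number of cells of the polyomino sharing an edge with it. The boundary cycle $H$ is the closed walk, once around the boundary of the polyomino, through the cells touching the boundary, consecutive cells sharing an edge (repetitions allowed); $h_1$ is the number of entries of $H$ that are cells of degree $1$. -}

module Defs where

open import Data.Nat as ℕ using (ℕ; zero; suc; _≤ᵇ_)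
open import Data.Integer as ℤ using (ℤ; +_)
open import Data.Integer.Properties as ℤP using ()
open import Data.Product using (_×_; _,_; Σ; ∃-syntax)
open import Data.Product.Properties using (≡-dec)
open import Data.Bool using (if_then_else_)
open import Data.List using (List; []; _∷_; length; map; filter)
open import Data.Nat.ListAction using (sum)
open import Data.List.Relation.Unary.Unique.Propositional using (Unique)
open import Relation.Nullary using (¬_; Dec)
open import Relation.Binary.PropositionalEquality using (_≡_)
open import Relation.Binary.Definitions using (DecidableEquality)

-- A cell of the integer grid is identified by the integer coordinates of
-- its lower-left corner.
Cell : Set
Cell = ℤ × ℤ

_≟ᶜ_ : DecidableEquality Cell
_≟ᶜ_ = ≡-dec ℤP._≟_ ℤP._≟_

open import Data.List.Membership.DecPropositional _≟ᶜ_ public using (_∈_; _∈?_)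

edgeNeighbours : Cell → List Cell
edgeNeighbours (x , y) =
  (x ℤ.+ + 1 , y) ∷ (x ℤ.- + 1 , y) ∷ (x , y ℤ.+ + 1) ∷ (x , y ℤ.- + 1) ∷ []

Adjacent : Cell → Cell → Set
Adjacent c d = d ∈ edgeNeighbours c

data PathIn (P : List Cell) : Cell → Cell → Set where
  here  : ∀ {c} → PathIn P c c
  step  : ∀ {c e d} → Adjacent c e → e ∈ P → PathIn P e d → PathIn P c d

record IsPolyomino (P : List Cell) : Set where
  field
    distinct  : Unique P
    nonempty  : ¬ (P ≡ [])
    connected : ∀ {c d} → c ∈ P → d ∈ P → PathIn P c d

degree : List Cell → Cell → ℕ
degree P c = length (filter (_∈? P) (edgeNeighbours c))

freeSides : List Cell → Cell → ℕ
freeSides P c = length (filter (λ d → Relation.Nullary.¬? (d ∈? P)) (edgeNeighbours c))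

-- Perimeter: number of unit edges belonging to exactly one cell of P.
-- Each such edge belongs to exactly one cell c ∈ P, and is a free side of c.
perimeter : List Cell → ℕ
perimeter P = sum (map (freeSides P) P)

-- ⌈√m⌉ : least k with m ≤ k*k (found by search; k ≤ m suffices).
ceilSqrtAux : ℕ → ℕ → ℕ → ℕ
ceilSqrtAux zero    k m = k
ceilSqrtAux (suc f) k m = if m ≤ᵇ k ℕ.* k then k else ceilSqrtAux f (suc k) m

ceilSqrt : ℕ → ℕ
ceilSqrt m = ceilSqrtAux m 0 m

-- p(n) = 2 ⌈2 √n⌉ = 2 ⌈√(4n)⌉, the minimum perimeter of an n-cell polyomino.
minPerimeter : ℕ → ℕ
minPerimeter n = 2 ℕ.* ceilSqrt (4 ℕ.* n)

OnBoundary : List Cell → Cell → Set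
OnBoundary P c = c ∈ P × ¬ (freeSides P c ≡ 0)

H1Zero : List Cell → Set
H1Zero P = ∀ c → OnBoundary P c → ¬ (degree P c ≡ 1)

InRectangle : ℤ → ℤ → ℕ → ℕ → Cell → Set
InRectangle x₀ y₀ a b (x , y) =
  (x₀ ℤ.≤ x) × (x ℤ.< x₀ ℤ.+ + a) × (y₀ ℤ.≤ y) × (y ℤ.< y₀ ℤ.+ + b)

{-# OPTIONS --safe #-}
-- Every column between the leftmost and the rightmost cell of a polyomino contains a cell,
-- since the polyomino is connected and adjacent cells lie in columns at most one apart; the
-- topmost cell of that column has its upper side on the boundary. Counting upper, lower, left
-- and right boundary edges in this way gives perimeter P ≥ 2 (w + h) for the w × h bounding
-- box. So if perimeter P = p(n) = 2 S, then w + h ≤ S, and widening the bounding box to width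
-- S ∸ h gives a rectangle of perimeter p(n) containing P, hence with at least n cells.
module Submission where

open import Defs
open import Data.Nat using (ℕ; suc; _+_; _*_; _∸_; _≤_; _≥_; _<_; z≤n; s≤s)
open import Data.Integer using (ℤ; +_; +<+; +≤+)
open import Data.List using (List; []; _∷_; [_]; _++_; length; map; filter; applyUpTo; cartesianProduct)
open import Data.Product using (_×_; _,_; proj₁; proj₂; ∃-syntax)
open import Relation.Binary.PropositionalEquality using (_≡_; refl; sym; trans; cong; cong₂; subst; module ≡-Reasoning)
import Data.Nat.Properties as ℕP
open import Data.Nat.ListAction using (sum)
open import Data.Nat.Tactic.RingSolver as ℕ-Ring using ()
import Data.Integer as ℤ
import Data.Integer.Properties as ℤP
open import Data.Integer.Tactic.RingSolver as ℤ-Ring using ()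
open import Data.List.Properties using (length-++; length-++-sucʳ; length-map; length-applyUpTo; filter-++)
open import Data.List.Extrema ℤP.≤-totalOrder using (argmin; argmax; argmin-all; argmax-all; f[argmin]≤f[xs]; f[xs]≤f[argmax])
import Data.List.Relation.Unary.All as All
open import Data.List.Relation.Unary.Any using (here; there)
open import Data.List.Relation.Unary.AllPairs using ([]; _∷_)
open import Data.List.Relation.Unary.Unique.Propositional using (Unique)
open import Data.List.Relation.Unary.Unique.Propositional.Properties using (applyUpTo⁺₁)
open import Data.List.Relation.Binary.Subset.Propositional using (_⊆_)
-- The _∈_ of Defs is membership in lists of cells only.
open import Data.List.Membership.Propositional using () renaming (_∈_ to _∈ₗ_)
open import Data.List.Membership.Propositional.Properties
  using (∈-∃++; ∈-++⁻; ∈-++⁺ˡ; ∈-++⁺ʳ; ∈-map⁺; ∈-filter⁺; ∈-filter⁻; ∈-applyUpTo⁺; ∈-applyUpTo⁻; ∈-cartesianProduct⁺)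
open import Data.Sum using (inj₁; inj₂)
open import Data.Bool using (true; false)
open import Data.Empty using (⊥-elim)
open import Function using (_∘_; id)
open import Relation.Nullary using (¬_; yes; no; does; ¬?)
open import Relation.Unary using (Decidable)

module _ {A : Set} where

  unique-⊆⇒length≤ : {xs ys : List A} → Unique xs → xs ⊆ ys → length xs ≤ length ys
  unique-⊆⇒length≤ [] _ = z≤n
  unique-⊆⇒length≤ {x ∷ xs} (x∉xs ∷ unique-xs) xs⊆ys with ∈-∃++ (xs⊆ys (here refl))
  ... | us , vs , refl =
    subst (suc (length xs) ≤_) (sym (length-++-sucʳ us x vs))
      (s≤s (unique-⊆⇒length≤ unique-xs xs⊆us++vs))
    where
    xs⊆us++vs : xs ⊆ us ++ vs
    xs⊆us++vs z∈xs with ∈-++⁻ us (xs⊆ys (there z∈xs))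
    ... | inj₁ z∈us          = ∈-++⁺ˡ z∈us
    ... | inj₂ (here refl)   = ⊥-elim (All.lookup x∉xs z∈xs refl)
    ... | inj₂ (there z∈vs)  = ∈-++⁺ʳ us z∈vs

  length-filter-∷ : ∀ {Q : A → Set} (Q? : Decidable Q) x xs →
                    length (filter Q? (x ∷ xs)) ≡ length (filter Q? [ x ]) + length (filter Q? xs)
  length-filter-∷ Q? x xs = trans (cong length (filter-++ Q? [ x ] xs)) (length-++ (filter Q? [ x ]))

module _ {A B : Set} where

  length-filter-map : ∀ {Q : B → Set} (Q? : Decidable Q) (f : A → B) xs →
                      length (filter Q? (map f xs)) ≡ length (filter (Q? ∘ f) xs)
  length-filter-map Q? f [] = refl
  length-filter-map Q? f (x ∷ xs) with does (Q? (f x))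
  ... | true  = cong suc (length-filter-map Q? f xs)
  ... | false = length-filter-map Q? f xs

  length-cartesianProduct : (xs : List A) (ys : List B) →
                            length (cartesianProduct xs ys) ≡ length xs * length ys
  length-cartesianProduct []       ys = refl
  length-cartesianProduct (x ∷ xs) ys = begin
    length (map (x ,_) ys ++ cartesianProduct xs ys)
      ≡⟨ length-++ (map (x ,_) ys) ⟩
    length (map (x ,_) ys) + length (cartesianProduct xs ys)
      ≡⟨ cong₂ _+_ (length-map (x ,_) ys) (length-cartesianProduct xs ys) ⟩
    length ys + length xs * length ys
      ∎
    where open ≡-Reasoning

module _ {A : Set} (f : A → ℤ) {xs : List A} {x₀ : A} (x₀∈xs : x₀ ∈ₗ xs) where

  argmin∈ : argmin f x₀ xs ∈ₗ xs
  argmin∈ = argmin-all f {P = _∈ₗ xs} x₀∈xs (All.tabulate id)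

  argmin≤ : ∀ {x} → x ∈ₗ xs → f (argmin f x₀ xs) ℤ.≤ f x
  argmin≤ = All.lookup (f[argmin]≤f[xs] x₀ xs)

  argmax∈ : argmax f x₀ xs ∈ₗ xs
  argmax∈ = argmax-all f {P = _∈ₗ xs} x₀∈xs (All.tabulate id)

  ≤argmax : ∀ {x} → x ∈ₗ xs → f x ℤ.≤ f (argmax f x₀ xs)
  ≤argmax = All.lookup (f[xs]≤f[argmax] x₀ xs)

i<i+1 : ∀ i → i ℤ.< i ℤ.+ + 1
i<i+1 i = ℤP.suc[i]≤j⇒i<j (ℤP.≤-reflexive (ℤP.+-comm (+ 1) i))

i-1+1≡i : ∀ i → i ℤ.- + 1 ℤ.+ + 1 ≡ i
i-1+1≡i = ℤ-Ring.solve-∀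

i-1<i : ∀ i → i ℤ.- + 1 ℤ.< i
i-1<i i = subst (i ℤ.- + 1 ℤ.<_) (i-1+1≡i i) (i<i+1 (i ℤ.- + 1))

i<j⇒i+1≤j : ∀ {i j} → i ℤ.< j → i ℤ.+ + 1 ℤ.≤ j
i<j⇒i+1≤j {i} {j} i<j = subst (ℤ._≤ j) (ℤP.+-comm (+ 1) i) (ℤP.i<j⇒suc[i]≤j i<j)

i+[j-i]≡j : ∀ i j → i ℤ.+ (j ℤ.- i) ≡ j
i+[j-i]≡j = ℤ-Ring.solve-∀

i+∣j-i∣≡j : ∀ {i j} → i ℤ.≤ j → i ℤ.+ + ℤ.∣ j ℤ.- i ∣ ≡ j
i+∣j-i∣≡j {i} {j} i≤j =
  trans (cong (ℤ._+_ i) (ℤP.0≤i⇒+∣i∣≡i (ℤP.i≤j⇒0≤j-i i≤j))) (i+[j-i]≡j i j)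

interval : ℤ → ℕ → List ℤ
interval lo = applyUpTo (λ i → lo ℤ.+ + i)

interval-unique : ∀ lo k → Unique (interval lo k)
interval-unique lo k = applyUpTo⁺₁ _ k (λ i<j _ → ℤP.<⇒≢ (ℤP.+-monoʳ-< lo (+<+ i<j)))

∈-interval⁺ : ∀ {lo y} k → lo ℤ.≤ y → y ℤ.< lo ℤ.+ + k → y ∈ₗ interval lo k
∈-interval⁺ {lo} {y} k lo≤y y<lo+k =
  subst (_∈ₗ interval lo k) (i+∣j-i∣≡j lo≤y) (∈-applyUpTo⁺ (λ i → lo ℤ.+ + i) offset<k)
  where
  offset<k : ℤ.∣ y ℤ.- lo ∣ < k
  offset<k = ℕP.≰⇒> λ k≤offset → ℤP.<⇒≱ y<lo+k
    (subst (lo ℤ.+ + k ℤ.≤_) (i+∣j-i∣≡j lo≤y) (ℤP.+-monoʳ-≤ lo (+≤+ k≤offset)))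

span : ℤ → ℤ → ℕ
span lo hi = suc ℤ.∣ hi ℤ.- lo ∣

≤⇒<+span : ∀ {lo hi y} → lo ℤ.≤ hi → y ℤ.≤ hi → y ℤ.< lo ℤ.+ + span lo hi
≤⇒<+span {lo} {hi} lo≤hi y≤hi = ℤP.≤-<-trans y≤hi
  (subst (ℤ._< lo ℤ.+ + span lo hi) (i+∣j-i∣≡j lo≤hi) (ℤP.+-monoʳ-< lo (+<+ (ℕP.n<1+n _))))

∈-interval-span⁻ : ∀ {lo hi y} → lo ℤ.≤ hi → y ∈ₗ interval lo (span lo hi) → lo ℤ.≤ y × y ℤ.≤ hi
∈-interval-span⁻ {lo} {hi} lo≤hi y∈ with ∈-applyUpTo⁻ (λ i → lo ℤ.+ + i) y∈
... | i , i<span , refl = ℤP.i≤i+j lo (+ i) ,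
  subst (lo ℤ.+ + i ℤ.≤_) (i+∣j-i∣≡j lo≤hi) (ℤP.+-monoʳ-≤ lo (+≤+ (ℕP.≤-pred i<span)))

rectangle : ℤ → ℤ → ℕ → ℕ → List Cell
rectangle x₀ y₀ a b = cartesianProduct (interval x₀ a) (interval y₀ b)

InRectangle⇒∈rectangle : ∀ {x₀ y₀ a b} c → InRectangle x₀ y₀ a b c → c ∈ rectangle x₀ y₀ a b
InRectangle⇒∈rectangle {a = a} {b} c (x₀≤x , x<x₀+a , y₀≤y , y<y₀+b) =
  ∈-cartesianProduct⁺ (∈-interval⁺ a x₀≤x x<x₀+a) (∈-interval⁺ b y₀≤y y<y₀+b)

InRectangle-widen : ∀ {x₀ y₀ a a′ b} c → a ≤ a′ → InRectangle x₀ y₀ a b c → InRectangle x₀ y₀ a′ b c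
InRectangle-widen {x₀} c a≤a′ (x₀≤x , x<x₀+a , y-bounds) =
  x₀≤x , ℤP.<-≤-trans x<x₀+a (ℤP.+-monoʳ-≤ x₀ (+≤+ a≤a′)) , y-bounds

length≤area : ∀ {P x₀ y₀ a b} → Unique P → (∀ c → c ∈ P → InRectangle x₀ y₀ a b c) → length P ≤ a * b
length≤area {P} {x₀} {y₀} {a} {b} unique P⊆box = begin
  length P
    ≤⟨ unique-⊆⇒length≤ unique (λ {c} c∈P → InRectangle⇒∈rectangle c (P⊆box c c∈P)) ⟩
  length (rectangle x₀ y₀ a b)
    ≡⟨ length-cartesianProduct (interval x₀ a) (interval y₀ b) ⟩
  length (interval x₀ a) * length (interval y₀ b)
    ≡⟨ cong₂ _*_ (length-applyUpTo _ a) (length-applyUpTo _ b) ⟩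
  a * b
    ∎
  where open ℕP.≤-Reasoning

east west north south : Cell → Cell
east  (x , y) = x ℤ.+ + 1 , y
west  (x , y) = x ℤ.- + 1 , y
north (x , y) = x , y ℤ.+ + 1
south (x , y) = x , y ℤ.- + 1

exposed : (Cell → Cell) → List Cell → List Cell → List Cell
exposed s P = filter (λ c → ¬? (s c ∈? P))

freeSides-by-direction : ∀ P c → freeSides P c ≡
  length (exposed east P [ c ]) + (length (exposed west P [ c ]) +
    (length (exposed north P [ c ]) + length (exposed south P [ c ])))
freeSides-by-direction P c =
  trans (length-filter-∷ outside? (east c) _) (cong₂ _+_ (side east)
  (trans (length-filter-∷ outside? (west c) _) (cong₂ _+_ (side west)
  (trans (length-filter-∷ outside? (north c) _) (cong₂ _+_ (side north) (side south))))))
  where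
  outside? : Decidable (λ d → ¬ (d ∈ P))
  outside? d = ¬? (d ∈? P)
  side : ∀ s → length (filter outside? [ s c ]) ≡ length (exposed s P [ c ])
  side s = length-filter-map outside? s [ c ]

perimeter-by-direction : ∀ P → perimeter P ≡
  length (exposed east P P) + length (exposed west P P)
    + length (exposed north P P) + length (exposed south P P)
perimeter-by-direction P = sum-freeSides P
  where
  interchange : ∀ a b c d a′ b′ c′ d′ →
    (a + (b + (c + d))) + (a′ + b′ + c′ + d′) ≡ (a + a′) + (b + b′) + (c + c′) + (d + d′)
  interchange = ℕ-Ring.solve-∀
  count : (Cell → Cell) → List Cell → ℕ
  count s = length ∘ exposed s P
  count-∷ : ∀ s c L → count s (c ∷ L) ≡ count s [ c ] + count s L
  count-∷ s c L = length-filter-∷ _ c L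
  sum-freeSides : ∀ L → sum (map (freeSides P) L) ≡
    count east L + count west L + count north L + count south L
  sum-freeSides [] = refl
  sum-freeSides (c ∷ L) = begin
    freeSides P c + sum (map (freeSides P) L)
      ≡⟨ cong₂ _+_ (freeSides-by-direction P c) (sum-freeSides L) ⟩
    (count east [ c ] + (count west [ c ] + (count north [ c ] + count south [ c ])))
      + (count east L + count west L + count north L + count south L)
      ≡⟨ interchange (count east [ c ]) (count west [ c ]) (count north [ c ]) (count south [ c ])
                     (count east L) (count west L) (count north L) (count south L) ⟩
    (count east [ c ] + count east L) + (count west [ c ] + count west L)
      + (count north [ c ] + count north L) + (count south [ c ] + count south L)
      ≡⟨ sym (cong₂ _+_ (cong₂ _+_ (cong₂ _+_ (count-∷ east c L) (count-∷ west c L))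
                                       (count-∷ north c L))
                            (count-∷ south c L)) ⟩
    count east (c ∷ L) + count west (c ∷ L) + count north (c ∷ L) + count south (c ∷ L)
      ∎
    where open ≡-Reasoning

sides≤perimeter : ∀ P {w h} →
  h ≤ length (exposed east P P) → h ≤ length (exposed west P P) →
  w ≤ length (exposed north P P) → w ≤ length (exposed south P P) → 2 * (w + h) ≤ perimeter P
sides≤perimeter P {w} {h} h≤east h≤west w≤north w≤south = begin
  2 * (w + h)   ≡⟨ 2[w+h]≡h+h+w+w w h ⟩
  h + h + w + w ≤⟨ ℕP.+-mono-≤ (ℕP.+-mono-≤ (ℕP.+-mono-≤ h≤east h≤west) w≤north) w≤south ⟩
  length (exposed east P P) + length (exposed west P P)
    + length (exposed north P P) + length (exposed south P P) ≡⟨ perimeter-by-direction P ⟨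
  perimeter P   ∎
  where
  open ℕP.≤-Reasoning
  2[w+h]≡h+h+w+w : ∀ w h → 2 * (w + h) ≡ h + h + w + w
  2[w+h]≡h+h+w+w = ℕ-Ring.solve-∀

-- Written for the upper sides of cells; the lower, right and left sides are the instances
-- below, e.g. lower sides with column = x and height = − y.
module Columns
  (column height : Cell → ℤ) (up : Cell → Cell)
  (column-up : ∀ c → column (up c) ≡ column c)
  (height-up : ∀ c → height c ℤ.< height (up c))
  (column-adjacent : ∀ {c d} → Adjacent c d → column d ℤ.≤ column c ℤ.+ + 1)
  where

  path-meets-column : ∀ {P c d x} → PathIn P c d → c ∈ P → column c ℤ.≤ x → x ℤ.≤ column d →
                      ∃[ e ] (e ∈ P × column e ≡ x)
  path-meets-column {c = c} here c∈P c≤x x≤c = c , c∈P , ℤP.≤-antisym c≤x x≤c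
  path-meets-column {c = c} {x = x} (step c~e e∈P e⇝d) c∈P c≤x x≤d with column c ℤ.≟ x
  ... | yes c≡x = c , c∈P , c≡x
  ... | no  c≢x = path-meets-column e⇝d e∈P
    (ℤP.≤-trans (column-adjacent c~e) (i<j⇒i+1≤j (ℤP.≤∧≢⇒< c≤x c≢x))) x≤d

  column-has-exposed : ∀ {P c} → c ∈ P → ∃[ m ] (m ∈ exposed up P P × column m ≡ column c)
  column-has-exposed {P} {c} c∈P = m , ∈-filter⁺ _ (proj₁ m∈column) up-m∉P , proj₂ m∈column
    where
    sameColumn? : Decidable (λ e → column e ≡ column c)
    sameColumn? e = column e ℤ.≟ column c
    m : Cell
    m = argmax height c (filter sameColumn? P)
    m∈column : m ∈ P × column m ≡ column c
    m∈column = argmax-all height {P = λ e → e ∈ P × column e ≡ column c}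
      (c∈P , refl) (All.tabulate (∈-filter⁻ sameColumn?))
    up-m∉P : ¬ (up m ∈ P)
    up-m∉P up-m∈P = ℤP.<⇒≱ (height-up m)
      (All.lookup (f[xs]≤f[argmax] {f = height} c (filter sameColumn? P))
        (∈-filter⁺ sameColumn? up-m∈P (trans (column-up m) (proj₂ m∈column))))

  span≤exposed : ∀ {P c d} → IsPolyomino P → c ∈ P → d ∈ P → column c ℤ.≤ column d →
                  span (column c) (column d) ≤ length (exposed up P P)
  span≤exposed {P} {c} {d} isP c∈P d∈P c≤d = begin
    span (column c) (column d)
      ≡⟨ length-applyUpTo (λ i → column c ℤ.+ + i) _ ⟨
    length (interval (column c) (span (column c) (column d)))
      ≤⟨ unique-⊆⇒length≤ (interval-unique (column c) _) covered ⟩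
    length (map column (exposed up P P))
      ≡⟨ length-map column (exposed up P P) ⟩
    length (exposed up P P)
      ∎
    where
    open ℕP.≤-Reasoning
    covered : interval (column c) (span (column c) (column d)) ⊆ map column (exposed up P P)
    covered x∈ with ∈-interval-span⁻ c≤d x∈
    ... | c≤x , x≤d with path-meets-column (IsPolyomino.connected isP c∈P d∈P) c∈P c≤x x≤d
    ... | e , e∈P , refl with column-has-exposed e∈P
    ... | m , m∈exposed , m-column =
      subst (_∈ₗ map column (exposed up P P)) m-column (∈-map⁺ column m∈exposed)

proj₁-adjacent : ∀ {c d} → Adjacent c d → proj₁ d ℤ.≤ proj₁ c ℤ.+ + 1
proj₁-adjacent (here refl) = ℤP.≤-refl
proj₁-adjacent {x , _} (there (here refl)) = ℤP.<⇒≤ (ℤP.<-trans (i-1<i x) (i<i+1 x))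
proj₁-adjacent {x , _} (there (there (here refl))) = ℤP.<⇒≤ (i<i+1 x)
proj₁-adjacent {x , _} (there (there (there (here refl)))) = ℤP.<⇒≤ (i<i+1 x)

proj₂-adjacent : ∀ {c d} → Adjacent c d → proj₂ d ℤ.≤ proj₂ c ℤ.+ + 1
proj₂-adjacent {_ , y} (here refl) = ℤP.<⇒≤ (i<i+1 y)
proj₂-adjacent {_ , y} (there (here refl)) = ℤP.<⇒≤ (i<i+1 y)
proj₂-adjacent (there (there (here refl))) = ℤP.≤-refl
proj₂-adjacent {_ , y} (there (there (there (here refl)))) = ℤP.<⇒≤ (ℤP.<-trans (i-1<i y) (i<i+1 y))

module North = Columns proj₁ proj₂ north (λ _ → refl) (λ c → i<i+1 (proj₂ c)) proj₁-adjacent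
module South = Columns proj₁ (ℤ.-_ ∘ proj₂) south (λ _ → refl)
                 (λ c → ℤP.neg-mono-< (i-1<i (proj₂ c))) proj₁-adjacent
module East  = Columns proj₂ proj₁ east (λ _ → refl) (λ c → i<i+1 (proj₁ c)) proj₂-adjacent
module West  = Columns proj₂ (ℤ.-_ ∘ proj₁) west (λ _ → refl)
                 (λ c → ℤP.neg-mono-< (i-1<i (proj₁ c))) proj₂-adjacent

some-cell : ∀ {P} → IsPolyomino P → ∃[ c ] (c ∈ P)
some-cell {[]}    isP = ⊥-elim (IsPolyomino.nonempty isP refl)
some-cell {c ∷ _} _   = c , here refl

record EnclosingRectangle (P : List Cell) : Set where
  field
    x₀ y₀ : ℤ
    w h : ℕ
    1≤w : 1 ≤ w
    1≤h : 1 ≤ h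
    2[w+h]≤perimeter : 2 * (w + h) ≤ perimeter P
    P⊆rectangle : ∀ c → c ∈ P → InRectangle x₀ y₀ w h c

boundingBox : ∀ {P} → IsPolyomino P → EnclosingRectangle P
boundingBox {P} isP = record
  { x₀ = x₀ ; y₀ = y₀ ; w = span x₀ x₁ ; h = span y₀ y₁ ; 1≤w = s≤s z≤n ; 1≤h = s≤s z≤n
  ; 2[w+h]≤perimeter = box≤perimeter ; P⊆rectangle = inside }
  where
  c₀ : Cell
  c₀ = proj₁ (some-cell isP)
  c₀∈P : c₀ ∈ P
  c₀∈P = proj₂ (some-cell isP)
  x₀ x₁ y₀ y₁ : ℤ
  x₀ = proj₁ (argmin proj₁ c₀ P)
  x₁ = proj₁ (argmax proj₁ c₀ P)
  y₀ = proj₂ (argmin proj₂ c₀ P)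
  y₁ = proj₂ (argmax proj₂ c₀ P)
  x₀≤x₁ : x₀ ℤ.≤ x₁
  x₀≤x₁ = argmin≤ proj₁ c₀∈P (argmax∈ proj₁ c₀∈P)
  y₀≤y₁ : y₀ ℤ.≤ y₁
  y₀≤y₁ = argmin≤ proj₂ c₀∈P (argmax∈ proj₂ c₀∈P)
  box≤perimeter : 2 * (span x₀ x₁ + span y₀ y₁) ≤ perimeter P
  box≤perimeter = sides≤perimeter P
    (East.span≤exposed isP (argmin∈ proj₂ c₀∈P) (argmax∈ proj₂ c₀∈P) y₀≤y₁)
    (West.span≤exposed isP (argmin∈ proj₂ c₀∈P) (argmax∈ proj₂ c₀∈P) y₀≤y₁)
    (North.span≤exposed isP (argmin∈ proj₁ c₀∈P) (argmax∈ proj₁ c₀∈P) x₀≤x₁)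
    (South.span≤exposed isP (argmin∈ proj₁ c₀∈P) (argmax∈ proj₁ c₀∈P) x₀≤x₁)
  inside : ∀ c → c ∈ P → InRectangle x₀ y₀ (span x₀ x₁) (span y₀ y₁) c
  inside c c∈P = argmin≤ proj₁ c₀∈P c∈P , ≤⇒<+span x₀≤x₁ (≤argmax proj₁ c₀∈P c∈P)
               , argmin≤ proj₂ c₀∈P c∈P , ≤⇒<+span y₀≤y₁ (≤argmax proj₂ c₀∈P c∈P)

lemma5 : (n : ℕ) (P : List Cell) → IsPolyomino P → length P ≡ n
    → perimeter P ≡ minPerimeter n → H1Zero P
    → ∃[ a ] ∃[ b ] ∃[ x₀ ] ∃[ y₀ ]
        (1 ≤ a × 1 ≤ b × 2 * (a + b) ≡ minPerimeter n × a * b ≥ n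
          × (∀ c → c ∈ P → InRectangle x₀ y₀ a b c))
lemma5 n P isP |P|≡n perimeter≡p _ =
  S ∸ h , h , x₀ , y₀ , ℕP.≤-trans 1≤w w≤S∸h , 1≤h , cong (2 *_) (ℕP.m∸n+n≡m h≤S) , area , P⊆widened
  where
  open EnclosingRectangle (boundingBox isP)
  S : ℕ
  S = ceilSqrt (4 * n)
  w+h≤S : w + h ≤ S
  w+h≤S = ℕP.*-cancelˡ-≤ 2 (subst (2 * (w + h) ≤_) perimeter≡p 2[w+h]≤perimeter)
  h≤S : h ≤ S
  h≤S = ℕP.≤-trans (ℕP.m≤n+m h w) w+h≤S
  w≤S∸h : w ≤ S ∸ h
  w≤S∸h = ℕP.m+n≤o⇒m≤o∸n w w+h≤S
  P⊆widened : ∀ c → c ∈ P → InRectangle x₀ y₀ (S ∸ h) h c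
  P⊆widened c c∈P = InRectangle-widen c w≤S∸h (P⊆rectangle c c∈P)
  area : (S ∸ h) * h ≥ n
  area = subst (_≤ (S ∸ h) * h) |P|≡n (length≤area (IsPolyomino.distinct isP) P⊆widened)
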